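{- Let $\phi_{\mathrm{xor}}$ be a conjunction of xor-constraints, let $x$ be a variable and let $(V_a,V_b)$ be an $x$-cut partition of $\phi_{\mathrm{xor}}$. Let $\phi^a = \bigwedge_{D \in V_a} D$, $\phi^b = \bigwedge_{D \in V_b} D$, and let $\tilde{l}_1,\dots,\tilde{l}_k,\hat{l}$ be literals over the variables of $\phi_{\mathrm{xor}}$. Then: (I) If $\phi_{\mathrm{xor}} \land \tilde{l}_1\land\dots\land\tilde{l}_k$ is unsatisfiable, then either (1) $\phi^a \land \tilde{l}_1\land\dots\land\tilde{l}_k$ or $\phi^b \land \tilde{l}_1\land\dots\land\tilde{l}_k$ is unsatisfiable; or (2) for some $p_x\in\{\bot,\top\}$, $\phi^a \land \tilde{l}_1\land\dots\land\tilde{l}_k \models (x\equiv p_x)$ and $\phi^b \land \tilde{l}_1\land\dots\land\tilde{l}_k \models (x\equiv p_x\oplus\top)$. (II) If $\phi_{\mathrm{xor}} \land \tilde{l}_1\land\dots\land\tilde{l}_k$ is satisfiable and $\phi_{\mathrm{xor}} \land \tilde{l}_1\land\dots\land\tilde{l}_k \models \hat{l}$, then either (1) $\phi^a \land \tilde{l}_1\land\dots\land\tilde{l}_k \models \hat{l}$ or $\phi^b \land \tilde{l}_1\land\dots\land\tilde{l}_k \models \hat{l}$; or (2) for some $p_x\in\{\bot,\top\}$, $\phi^a \land \tilde{l}_1\land\dots\land\tilde{l}_k \models (x\equiv p_x)$ and $\phi^b \land \tilde{l}_1\land\dots\land\tilde{l}_k\land(x\equiv p_x) \models \hat{l}$;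 or (3) for some $p_x\in\{\bot,\top\}$, $\phi^b \land \tilde{l}_1\land\dots\land\tilde{l}_k \models (x\equiv p_x)$ and $\phi^a \land \tilde{l}_1\land\dots\land\tilde{l}_k\land(x\equiv p_x) \models \hat{l}$.
   Context: Truth values are $\mathbb{B}=\{\bot,\top\}$. An xor-constraint is an equation $x_1 \oplus \dots \oplus x_k \equiv p$ with Boolean variables $x_i$ and parity $p\in\mathbb{B}$ (duplicate variables cancel in pairs); a truth assignment $\tau$ satisfies it if $\tau(x_1)\oplus\dots\oplus\tau(x_k)=p$. A literal is a variable $y$ or its negation $\neg y$, identified with the xor-constraints $y\equiv\top$ and $y\equiv\bot$ respectively. For a set $V$ of xor-constraints, $\mathrm{vars}(V)$ is the set of variables occurring in them. A variable $x$ of $\phi_{\mathrm{xor}}$ determines an $x$-cut partition $(V_a,V_b)$ of $\phi_{\mathrm{xor}}$: a partition of the set of xor-constraints of $\phi_{\mathrm{xor}}$ into two sets $V_a,V_b$ with $\mathrm{vars}(V_a)\cap\mathrm{vars}(V_b)=\{x\}$. -}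

module Defs where

open import Data.Bool using (Bool; true; false; _xor_; not)
open import Data.Nat using (ℕ)
open import Data.List using (List; []; _∷_; _++_; foldr; concatMap; map)
open import Data.List.Membership.Propositional using (_∈_)
open import Data.List.Relation.Binary.Permutation.Propositional using (_↭_)
open import Data.List.Relation.Unary.All using (All)
open import Data.Product using (Σ; _×_; ∃)
open import Relation.Binary.PropositionalEquality using (_≡_)
open import Function.Bundles using (_⇔_)
open import Data.Empty using (⊥)

-- Variables are natural numbers; truth values are Bool (false = ⊥, true = ⊤).
Var : Set
Var = ℕ

Assignment : Set
Assignment = Var → Bool

-- An xor-constraint x₁ ⊕ … ⊕ xₖ ≡ p : a list of variables (duplicates allowed,
-- they cancel semantically) and a parity p.
record XorConstraint : Set where
  constructor xc
  field
    xvars  : List Var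
    parity : Bool
open XorConstraint public

xorVal : Assignment → List Var → Bool
xorVal τ = foldr (λ v b → τ v xor b) false

_satisfies_ : Assignment → XorConstraint → Set
τ satisfies C = xorVal τ (xvars C) ≡ parity C

Formula : Set
Formula = List XorConstraint

_satisfiesAll_ : Assignment → Formula → Set
τ satisfiesAll φ = All (τ satisfies_) φ

vars : Formula → List Var
vars = concatMap xvars

data Literal : Set where
  pos : Var → Literal
  neg : Var → Literal

litVar : Literal → Var
litVar (pos y) = y
litVar (neg y) = y

litC : Literal → XorConstraint
litC (pos y) = xc (y ∷ []) true
litC (neg y) = xc (y ∷ []) false

lits : List Literal → Formula
lits = map litC

unitC : Var → Bool → XorConstraint
unitC x p = xc (x ∷ []) p

Satisfiable : Formula → Set
Satisfiable φ = ∃ λ τ → τ satisfiesAll φ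

Unsatisfiable : Formula → Set
Unsatisfiable φ = ∀ τ → τ satisfiesAll φ → ⊥

_⊨_ : Formula → XorConstraint → Set
φ ⊨ C = ∀ τ → τ satisfiesAll φ → τ satisfies C

IsXCut : Formula → Var → Formula → Formula → Set
IsXCut φ x Va Vb =
  (φ ↭ (Va ++ Vb)) ×
  (∀ y → ((y ∈ vars Va) × (y ∈ vars Vb)) ⇔ (y ≡ x))

-- Write L for the literals.  Models τa of φᵃ ∧ L and τb of φᵇ ∧ L that agree on x glue to a
-- model of φ ∧ L: take τa on vars φᵃ and τb elsewhere.  The cut makes x the only shared
-- variable, the literals survive because the glued assignment takes each value from τa or
-- τb, and the glued model agrees with τa on vars φᵃ.
-- (I) If φ ∧ L is unsatisfiable but both halves are satisfiable, every model of one half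
-- disagrees on x with every model of the other, so each half forces x, to opposite values.
-- (II) Say l̂ is over vars φᵃ and τ₀ ⊨ φ ∧ L.  If φᵇ ∧ L also has a model with x ≠ τ₀ x,
-- every model of φᵃ ∧ L has a partner to glue with, and inherits l̂ from the glued model;
-- otherwise φᵇ ∧ L forces x ≡ τ₀ x, and models of φᵃ ∧ L with that value glue with τ₀.
-- All case splits are constructive: satisfiability is decided by enumerating the values
-- of an assignment on the finitely many variables of the formula.

module Submission where

open import Defs
open import Data.Bool using (Bool; true; false; _xor_; not)
open import Data.Bool.Properties using (xor-identityʳ; xor-comm; true-xor; ¬-not) renaming (_≟_ to _≟ᵇ_)
open import Data.Nat using (_≟_)
open import Data.List using (List; []; _∷_; _++_; map)
open import Data.List.Properties using (++-assoc; concatMap-++)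
open import Data.List.Membership.Propositional using (_∈_)
open import Data.List.Membership.Propositional.Properties
  using (∈-++⁺ˡ; ∈-++⁺ʳ; ∈-++⁻; ∈-map⁺; ∈-map⁻; ∈-concat⁺′; ∈-concat⁻′)
open import Data.List.Membership.DecPropositional _≟_ using (_∈?_)
open import Data.List.Relation.Unary.Any using (here; there)
open import Data.List.Relation.Unary.All using (All; []; _∷_; all?)
open import Data.List.Relation.Unary.All.Properties using (++⁺; ++⁻ˡ; ++⁻ʳ; ∷ʳ⁺; ∷ʳ⁻)
open import Data.List.Relation.Binary.Permutation.Propositional using (_↭_; ↭-sym; ↭-trans)
open import Data.List.Relation.Binary.Permutation.Propositional.Properties
  using (All-resp-↭; ∈-resp-↭; ++-comm)
open import Data.Product using (Σ; _×_; _,_; proj₂; ∃)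
open import Data.Sum using (_⊎_; inj₁; inj₂; [_,_]′)
import Data.Sum as Sum
open import Data.Empty using (⊥-elim)
open import Relation.Nullary using (Dec; yes; no)
open import Relation.Nullary.Decidable using (_⊎-dec_)
open import Relation.Binary.PropositionalEquality using (_≡_; _≢_; refl; sym; trans; cong₂; subst)
open import Function using (_∘_; case_of_)
open import Function.Bundles using (Equivalence)

AgreeOn : List Var → Assignment → Assignment → Set
AgreeOn W τ σ = ∀ v → v ∈ W → τ v ≡ σ v

xorVal-cong : ∀ vs {τ σ} → AgreeOn vs τ σ → xorVal τ vs ≡ xorVal σ vs
xorVal-cong []       _  = refl
xorVal-cong (v ∷ vs) ag = cong₂ _xor_ (ag v (here refl)) (xorVal-cong vs (λ u m → ag u (there m)))

satisfiesAll-cong : ∀ F {τ σ} → AgreeOn (vars F) τ σ → τ satisfiesAll F → σ satisfiesAll F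
satisfiesAll-cong []      _  []       = []
satisfiesAll-cong (C ∷ F) ag (s ∷ ss) =
  trans (sym (xorVal-cong (xvars C) (λ u m → ag u (∈-++⁺ˡ m)))) s
  ∷ satisfiesAll-cong F (λ u m → ag u (∈-++⁺ʳ (xvars C) m)) ss

∈-vars-resp-↭ : ∀ {φ ψ z} → φ ↭ ψ → z ∈ vars φ → z ∈ vars ψ
∈-vars-resp-↭ {φ} p z∈ with ∈-concat⁻′ (map xvars φ) z∈
... | vs , z∈vs , vs∈ with ∈-map⁻ xvars vs∈
... | C , C∈φ , refl = ∈-concat⁺′ z∈vs (∈-map⁺ xvars (∈-resp-↭ p C∈φ))

∈-vars-++⁻ : ∀ A {B z} → z ∈ vars (A ++ B) → z ∈ vars A ⊎ z ∈ vars B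
∈-vars-++⁻ A {B} z∈ = ∈-++⁻ (vars A) (subst (_ ∈_) (concatMap-++ xvars A B) z∈)

satisfies-unitC⁻ : ∀ τ x {p} → τ satisfies unitC x p → τ x ≡ p
satisfies-unitC⁻ τ x s = trans (sym (xor-identityʳ (τ x))) s

satisfies-unitC⁺ : ∀ τ x {p} → τ x ≡ p → τ satisfies unitC x p
satisfies-unitC⁺ τ x e = trans (xor-identityʳ (τ x)) e

litVal : Literal → Bool
litVal (pos _) = true
litVal (neg _) = false

satisfies-litC⁻ : ∀ τ l → τ satisfies litC l → τ (litVar l) ≡ litVal l
satisfies-litC⁻ τ (pos y) = satisfies-unitC⁻ τ y
satisfies-litC⁻ τ (neg y) = satisfies-unitC⁻ τ y

satisfies-litC⁺ : ∀ τ l → τ (litVar l) ≡ litVal l → τ satisfies litC l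
satisfies-litC⁺ τ (pos y) = satisfies-unitC⁺ τ y
satisfies-litC⁺ τ (neg y) = satisfies-unitC⁺ τ y

satisfiesAll-lits-pointwise : ∀ ls σ {τa τb} → (∀ v → σ v ≡ τa v ⊎ σ v ≡ τb v) →
  τa satisfiesAll lits ls → τb satisfiesAll lits ls → σ satisfiesAll lits ls
satisfiesAll-lits-pointwise []       _ _  []         []         = []
satisfiesAll-lits-pointwise (l ∷ ls) σ {τa} {τb} σ~ (sa ∷ ssa) (sb ∷ ssb) =
  satisfies-litC⁺ σ l ([ (λ e → trans e (satisfies-litC⁻ τa l sa)) , (λ e → trans e (satisfies-litC⁻ τb l sb)) ]′
                         (σ~ (litVar l)))
  ∷ satisfiesAll-lits-pointwise ls σ σ~ ssa ssb

update : Assignment → Var → Bool → Assignment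
update τ w b v with v ≟ w
... | yes _ = b
... | no _  = τ v

update-cong : ∀ {W τ σ} w b → AgreeOn W τ σ → AgreeOn (w ∷ W) (update τ w b) (update σ w b)
update-cong w b ag v v∈ with v ≟ w | v∈
... | yes _  | _         = refl
... | no v≢w | here v≡w  = ⊥-elim (v≢w v≡w)
... | no _   | there v∈W = ag v v∈W

update-self : ∀ τ w v → τ v ≡ update τ w (τ w) v
update-self τ w v with v ≟ w
... | yes refl = refl
... | no _     = refl

Local : List Var → (Assignment → Set) → Set
Local W P = ∀ {τ σ} → AgreeOn W τ σ → P τ → P σ

∃?-local : ∀ W {P : Assignment → Set} → (∀ τ → Dec (P τ)) → Local W P → Dec (∃ P)
∃?-local [] {P} P? P-local with P? (λ _ → false)
... | yes p = yes (_ , p)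
... | no ¬p = no λ (τ , pτ) → ¬p (P-local (λ _ ()) pτ)
∃?-local (w ∷ W) {P} P? P-local with ∃?-local W {Extends} Extends? Extends-local
  where
  Extends : Assignment → Set
  Extends σ = P (update σ w false) ⊎ P (update σ w true)
  Extends? : ∀ σ → Dec (Extends σ)
  Extends? σ = P? (update σ w false) ⊎-dec P? (update σ w true)
  Extends-local : Local W Extends
  Extends-local ag = Sum.map (P-local (update-cong w false ag)) (P-local (update-cong w true ag))
... | yes (_ , inj₁ p) = yes (_ , p)
... | yes (_ , inj₂ p) = yes (_ , p)
... | no ¬ext = no λ (τ , pτ) → ¬ext (τ , extends τ (P-local (λ v _ → update-self τ w v) pτ))
  where
  extends : ∀ τ → P (update τ w (τ w)) → P (update τ w false) ⊎ P (update τ w true)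
  extends τ p with τ w
  ... | false = inj₁ p
  ... | true  = inj₂ p

satisfiable? : ∀ F → Dec (Satisfiable F)
satisfiable? F = ∃?-local (vars F) (λ τ → all? (λ C → xorVal τ (xvars C) ≟ᵇ parity C) F)
                   (satisfiesAll-cong F)

glue : List Var → Assignment → Assignment → Assignment
glue W τa τb v with v ∈? W
... | yes _ = τa v
... | no _  = τb v

glue-agreeˡ : ∀ W τa τb → AgreeOn W τa (glue W τa τb)
glue-agreeˡ W τa τb v v∈W with v ∈? W
... | yes _   = refl
... | no v∉W = ⊥-elim (v∉W v∈W)

glue-agreeʳ : ∀ W W′ τa τb → (∀ v → v ∈ W → v ∈ W′ → τa v ≡ τb v) → AgreeOn W′ τb (glue W τa τb)
glue-agreeʳ W W′ τa τb shared v v∈W′ with v ∈? W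
... | yes v∈W = sym (shared v v∈W v∈W′)
... | no _    = refl

glue-pointwise : ∀ W τa τb v → glue W τa τb v ≡ τa v ⊎ glue W τa τb v ≡ τb v
glue-pointwise W τa τb v with v ∈? W
... | yes _ = inj₁ refl
... | no _  = inj₂ refl

satisfiesAll-++-unitC⁻ : ∀ F G τ {x p} → τ satisfiesAll (F ++ G ++ unitC x p ∷ []) →
  τ satisfiesAll (F ++ G) × τ x ≡ p
satisfiesAll-++-unitC⁻ F G τ {x} s
  with ∷ʳ⁻ (subst (All (τ satisfies_)) (sym (++-assoc F G _)) s)
... | sFG , sx = sFG , satisfies-unitC⁻ τ x sx

satisfiesAll-++-unitC⁺ : ∀ F G τ {x p} → τ satisfiesAll (F ++ G) → τ x ≡ p →
  τ satisfiesAll (F ++ G ++ unitC x p ∷ [])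
satisfiesAll-++-unitC⁺ F G τ {x} sFG e =
  subst (All (τ satisfies_)) (++-assoc F G _) (∷ʳ⁺ sFG (satisfies-unitC⁺ τ x e))

module XCut (φ : Formula) (x : Var) (A B : Formula) (φ↭A++B : φ ↭ A ++ B)
           (shared : ∀ y → y ∈ vars A → y ∈ vars B → y ≡ x) (ls : List Literal) where

  L : Formula
  L = lits ls

  restrict : ∀ τ → τ satisfiesAll (φ ++ L) → τ satisfiesAll (A ++ L) × τ satisfiesAll (B ++ L)
  restrict τ s =
    let sAB = All-resp-↭ φ↭A++B (++⁻ˡ φ s)
        sL  = ++⁻ʳ φ s
    in ++⁺ (++⁻ˡ A sAB) sL , ++⁺ (++⁻ʳ A sAB) sL

  glue-models : ∀ τa τb → τa satisfiesAll (A ++ L) → τb satisfiesAll (B ++ L) → τa x ≡ τb x →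
    Σ Assignment λ τ → τ satisfiesAll (φ ++ L) × AgreeOn (vars A) τa τ
  glue-models τa τb sa sb τa≡τb = τ , ++⁺ (All-resp-↭ (↭-sym φ↭A++B) (++⁺ sA sB)) sL , agreeA
    where
    τ : Assignment
    τ = glue (vars A) τa τb
    agreeA : AgreeOn (vars A) τa τ
    agreeA = glue-agreeˡ (vars A) τa τb
    agreeB : AgreeOn (vars B) τb τ
    agreeB = glue-agreeʳ (vars A) (vars B) τa τb
               (λ v v∈A v∈B → subst (λ y → τa y ≡ τb y) (sym (shared v v∈A v∈B)) τa≡τb)
    sA : τ satisfiesAll A
    sA = satisfiesAll-cong A agreeA (++⁻ˡ A sa)
    sB : τ satisfiesAll B
    sB = satisfiesAll-cong B agreeB (++⁻ˡ B sb)
    sL : τ satisfiesAll L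
    sL = satisfiesAll-lits-pointwise ls τ (glue-pointwise (vars A) τa τb) (++⁻ʳ A sa) (++⁻ʳ B sb)

  unsat-cut : Unsatisfiable (φ ++ L) →
    (Unsatisfiable (A ++ L) ⊎ Unsatisfiable (B ++ L))
    ⊎ Σ Bool (λ px → ((A ++ L) ⊨ unitC x px) × ((B ++ L) ⊨ unitC x (px xor true)))
  unsat-cut unsat with satisfiable? (A ++ L) | satisfiable? (B ++ L)
  ... | no ¬sat | _       = inj₁ (inj₁ λ τ s → ¬sat (τ , s))
  ... | yes _   | no ¬sat = inj₁ (inj₂ λ τ s → ¬sat (τ , s))
  ... | yes (τa , sa) | yes (τb , sb) = inj₂ (τa x , A⊨ , B⊨)
    where
    disagree : ∀ σa σb → σa satisfiesAll (A ++ L) → σb satisfiesAll (B ++ L) → σa x ≢ σb x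
    disagree σa σb sa′ sb′ eq = let (τ , s , _) = glue-models σa σb sa′ sb′ eq in unsat τ s
    A⊨ : (A ++ L) ⊨ unitC x (τa x)
    A⊨ σ s = satisfies-unitC⁺ σ x (trans (¬-not (disagree σ τb s sb)) (sym (¬-not (disagree τa τb sa sb))))
    B⊨ : (B ++ L) ⊨ unitC x (τa x xor true)
    B⊨ σ s = satisfies-unitC⁺ σ x (trans (¬-not (disagree τa σ sa s ∘ sym))
                                         (trans (sym (true-xor (τa x))) (xor-comm true (τa x))))

  inherit-lit : ∀ lh → (φ ++ L) ⊨ litC lh → litVar lh ∈ vars A →
    ∀ σ τb → σ satisfiesAll (A ++ L) → τb satisfiesAll (B ++ L) → σ x ≡ τb x → σ satisfies litC lh
  inherit-lit lh ent lh∈A σ τb sa sb eq =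
    let (τ , s , agree) = glue-models σ τb sa sb eq
    in satisfies-litC⁺ σ lh (trans (agree (litVar lh) lh∈A) (satisfies-litC⁻ τ lh (ent τ s)))

  entails-cut : ∀ lh → Satisfiable (φ ++ L) → (φ ++ L) ⊨ litC lh → litVar lh ∈ vars A →
    ((A ++ L) ⊨ litC lh)
    ⊎ Σ Bool (λ px → ((B ++ L) ⊨ unitC x px) × ((A ++ L ++ unitC x px ∷ []) ⊨ litC lh))
  entails-cut lh (τ₀ , s₀) ent lh∈A with satisfiable? (B ++ L ++ unitC x (not (τ₀ x)) ∷ [])
  ... | yes (σb , s) = inj₁ A⊨
    where
    A⊨ : (A ++ L) ⊨ litC lh
    A⊨ σ sa with σ x ≟ᵇ τ₀ x | satisfiesAll-++-unitC⁻ B L σb s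
    ... | yes eq | _         = inherit-lit lh ent lh∈A σ τ₀ sa (proj₂ (restrict τ₀ s₀)) eq
    ... | no ne  | sb , σb≡ = inherit-lit lh ent lh∈A σ σb sa sb (trans (¬-not ne) (sym σb≡))
  ... | no ¬sat = inj₂ (τ₀ x , B⊨ , A⊨)
    where
    B⊨ : (B ++ L) ⊨ unitC x (τ₀ x)
    B⊨ σ s with σ x ≟ᵇ τ₀ x
    ... | yes eq = satisfies-unitC⁺ σ x eq
    ... | no ne  = ⊥-elim (¬sat (σ , satisfiesAll-++-unitC⁺ B L σ s (¬-not ne)))
    A⊨ : (A ++ L ++ unitC x (τ₀ x) ∷ []) ⊨ litC lh
    A⊨ σ s = let (sa , eq) = satisfiesAll-++-unitC⁻ A L σ s
             in inherit-lit lh ent lh∈A σ τ₀ sa (proj₂ (restrict τ₀ s₀)) eq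

theorem1 : (φ : Formula) (x : Var) (Va Vb : Formula) → IsXCut φ x Va Vb →
    (ls : List Literal) (lh : Literal) →
    All (λ l → litVar l ∈ vars φ) ls → litVar lh ∈ vars φ →
    ((Unsatisfiable (φ ++ lits ls) →
        (Unsatisfiable (Va ++ lits ls) ⊎ Unsatisfiable (Vb ++ lits ls))
        ⊎ Σ Bool (λ px → ((Va ++ lits ls) ⊨ unitC x px)
                        × ((Vb ++ lits ls) ⊨ unitC x (px xor true))))
    ×
    (Satisfiable (φ ++ lits ls) → (φ ++ lits ls) ⊨ litC lh →
        (((Va ++ lits ls) ⊨ litC lh) ⊎ ((Vb ++ lits ls) ⊨ litC lh))
        ⊎ (Σ Bool (λ px → ((Va ++ lits ls) ⊨ unitC x px)
                         × ((Vb ++ lits ls ++ unitC x px ∷ []) ⊨ litC lh))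
        ⊎ Σ Bool (λ px → ((Vb ++ lits ls) ⊨ unitC x px)
                         × ((Va ++ lits ls ++ unitC x px ∷ []) ⊨ litC lh)))))
theorem1 φ x Va Vb (φ↭ , shared⇔) ls lh _ lh∈φ = AB.unsat-cut , λ sat ent →
  case ∈-vars-++⁻ Va (∈-vars-resp-↭ φ↭ lh∈φ) of λ where
    (inj₁ lh∈a) → Sum.map inj₁ inj₂ (AB.entails-cut lh sat ent lh∈a)
    (inj₂ lh∈b) → Sum.map inj₂ inj₁ (BA.entails-cut lh sat ent lh∈b)
  where
  shared : ∀ y → y ∈ vars Va → y ∈ vars Vb → y ≡ x
  shared y y∈a y∈b = Equivalence.to (shared⇔ y) (y∈a , y∈b)
  module AB = XCut φ x Va Vb φ↭ shared ls
  module BA = XCut φ x Vb Va (↭-trans φ↭ (++-comm Va Vb)) (λ y y∈b y∈a → shared y y∈a y∈b) ls
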